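{- Let $\varphi$ be an expression such that $\mathcal{M}(\varphi)=\mathcal{B}(\varphi)$ (up to reordering). Then for every expression $\psi$ that is $\mathrm{B}_2$-equivalent to $\varphi$ (i.e. $\llbracket\varphi\rrbracket_u=\llbracket\psi\rrbracket_u$ for every binary valuation $u$) and for every valuation $v$ in $\mathrm{M}$, $|\llbracket\varphi\rrbracket_v|\ge|\llbracket\psi\rrbracket_v|$.
   Context: $\mathrm{M}$ denotes $\widehat{\mathbb{Z}}=(\mathbb{Z}\setminus\{0\})\cup\{ -\infty,\infty\}$ with $\land=\min$, $\lor=\max$, $\lnot a=-a$ and $|\pm\infty|=\infty$. Expressions are propositional formulas over variables $x_1,\ldots,x_n$ built with $\land,\lor,\lnot$ (no constants); $\llbracket\varphi\rrbracket_v$ is the value under a valuation $v$. A literal is $x$ or $\bar x$; a term is a conjunction of literals, identified with its set of literals; a subterm is a term with a subset of the literals. An implicant of $\varphi$ is a term $\gamma$ such that every binary valuation making $\gamma$ true makes $\varphi$ true; it is prime if no proper subterm of it is an implicant. The Blake Canonical Form $\mathcal{B}(\varphi)$ is the disjunction of all prime implicants of $\varphi$. The De Morgan Canonical Form $\mathcal{M}(\varphi)$ is the unique (up to reordering) expression obtained from $\varphi$ using only the laws of De Morgan algebras (commutativity, associativity, idempotence, absorption, distributivity, double negation, De Morgan laws) which is in disjunctive normal form, in which no term contains the same literal twice, and no term is a subterm of another (contradictory terms such as $x\bar x$ are not removed). -}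

module Defs where

open import Data.Bool using (Bool; true; false; not; _∧_; _∨_; if_then_else_)
open import Data.Nat using (ℕ; _≤_; _≤?_)
open import Data.Fin using (Fin)
open import Data.Fin.Properties using () renaming (_≟_ to _≟ᶠ_)
open import Data.List using (List; []; _∷_; _++_; map; concatMap; filterᵇ; deduplicateᵇ)
open import Data.Bool.ListAction using (all; any)
open import Data.List.Membership.Propositional using (_∈_)
open import Data.Product using (Σ; _×_; _,_; ∃)
open import Relation.Nullary using (¬_; does)
open import Relation.Binary.PropositionalEquality using (_≡_)

-- The algebra M = Ẑ = (ℤ ∖ {0}) ∪ {-∞, +∞}, in sign–magnitude form.
-- An element is a sign (true = positive) and a magnitude, which is
-- either a positive natural number (fin k  stands for k+1) or ∞.

data Mag : Set where
  fin : ℕ → Mag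
  ∞   : Mag

_≤ᵐᵇ_ : Mag → Mag → Bool
fin m ≤ᵐᵇ fin n = does (m ≤? n)
fin _ ≤ᵐᵇ ∞     = true
∞     ≤ᵐᵇ fin _ = false
∞     ≤ᵐᵇ ∞     = true

data _≤ᵐ_ : Mag → Mag → Set where
  fin≤fin : ∀ {m n} → m ≤ n → fin m ≤ᵐ fin n
  _≤∞     : ∀ a → a ≤ᵐ ∞

_==_ : Bool → Bool → Bool
true  == b = b
false == b = not b

record Ẑ : Set where
  constructor _·_
  field
    positive : Bool
    mag      : Mag
open Ẑ public

∣_∣ᶻ : Ẑ → Mag
∣ a ∣ᶻ = mag a

_≤ᶻᵇ_ : Ẑ → Ẑ → Bool
(true  · a) ≤ᶻᵇ (true  · b) = a ≤ᵐᵇ b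
(false · a) ≤ᶻᵇ (false · b) = b ≤ᵐᵇ a
(false · _) ≤ᶻᵇ (true  · _) = true
(true  · _) ≤ᶻᵇ (false · _) = false

minᶻ : Ẑ → Ẑ → Ẑ
minᶻ x y = if x ≤ᶻᵇ y then x else y

maxᶻ : Ẑ → Ẑ → Ẑ
maxᶻ x y = if x ≤ᶻᵇ y then y else x

negᶻ : Ẑ → Ẑ
negᶻ (s · m) = not s · m

data Expr (n : ℕ) : Set where
  var  : Fin n → Expr n
  _∧ₑ_ : Expr n → Expr n → Expr n
  _∨ₑ_ : Expr n → Expr n → Expr n
  ¬ₑ_  : Expr n → Expr n

⟦_⟧ᴹ : ∀ {n} → Expr n → (Fin n → Ẑ) → Ẑ
⟦ var i ⟧ᴹ v   = v i
⟦ a ∧ₑ b ⟧ᴹ v  = minᶻ (⟦ a ⟧ᴹ v) (⟦ b ⟧ᴹ v)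
⟦ a ∨ₑ b ⟧ᴹ v  = maxᶻ (⟦ a ⟧ᴹ v) (⟦ b ⟧ᴹ v)
⟦ ¬ₑ a ⟧ᴹ v    = negᶻ (⟦ a ⟧ᴹ v)

⟦_⟧ᴮ : ∀ {n} → Expr n → (Fin n → Bool) → Bool
⟦ var i ⟧ᴮ u   = u i
⟦ a ∧ₑ b ⟧ᴮ u  = ⟦ a ⟧ᴮ u ∧ ⟦ b ⟧ᴮ u
⟦ a ∨ₑ b ⟧ᴮ u  = ⟦ a ⟧ᴮ u ∨ ⟦ b ⟧ᴮ u
⟦ ¬ₑ a ⟧ᴮ u    = not (⟦ a ⟧ᴮ u)

-- (i , true) is x_i, (i , false) is x̄_i
Literal : ℕ → Set
Literal n = Fin n × Bool

-- a term is a conjunction of literals, identified with its set of literals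
Term : ℕ → Set
Term n = List (Literal n)

_==ˡ_ : ∀ {n} → Literal n → Literal n → Bool
(i , p) ==ˡ (j , q) = does (i ≟ᶠ j) ∧ (p == q)

Subterm : ∀ {n} → Term n → Term n → Set
Subterm s t = ∀ {l} → l ∈ s → l ∈ t

SameTerm : ∀ {n} → Term n → Term n → Set
SameTerm s t = Subterm s t × Subterm t s

ProperSubterm : ∀ {n} → Term n → Term n → Set
ProperSubterm s t = Subterm s t × ¬ Subterm t s

Contradictory : ∀ {n} → Term n → Set
Contradictory t = ∃ λ i → ((i , true) ∈ t) × ((i , false) ∈ t)

⟦_⟧ᵀ : ∀ {n} → Term n → (Fin n → Bool) → Bool
⟦ t ⟧ᵀ u = all (λ { (i , p) → u i == p }) t

Implicant : ∀ {n} → Expr n → Term n → Set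
Implicant φ γ = ∀ u → ⟦ γ ⟧ᵀ u ≡ true → ⟦ φ ⟧ᴮ u ≡ true

-- prime implicant (a term in the usual Blake sense: non-contradictory)
PrimeImplicant : ∀ {n} → Expr n → Term n → Set
PrimeImplicant φ γ =
  ¬ Contradictory γ × Implicant φ γ × (∀ δ → ProperSubterm δ γ → ¬ Implicant φ δ)

-- De Morgan canonical form, computed: push negations to the variables
-- and distribute (DNF as list of terms), remove repeated literals inside
-- terms, then apply absorption (drop every term having another term as a
-- proper subterm, and keep one copy of set-equal terms).  Contradictory
-- terms are not removed.

-- dnf p e : DNF of e (if p = true) or of ¬e (if p = false)
dnf : ∀ {n} → Bool → Expr n → List (Term n)
dnf true  (var i)  = (((i , true) ∷ []) ∷ [])
dnf false (var i)  = (((i , false) ∷ []) ∷ [])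
dnf p     (¬ₑ a)   = dnf (not p) a
dnf true  (a ∧ₑ b) = concatMap (λ s → map (λ t → s ++ t) (dnf true b)) (dnf true a)
dnf false (a ∧ₑ b) = dnf false a ++ dnf false b
dnf true  (a ∨ₑ b) = dnf true a ++ dnf true b
dnf false (a ∨ₑ b) = concatMap (λ s → map (λ t → s ++ t) (dnf false b)) (dnf false a)

_⊆ᵇ_ : ∀ {n} → Term n → Term n → Bool
s ⊆ᵇ t = all (λ l → any (l ==ˡ_) t) s

absorb : ∀ {n} → List (Term n) → List (Term n)
absorb ts =
  deduplicateᵇ (λ s t → (s ⊆ᵇ t) ∧ (t ⊆ᵇ s))
    (filterᵇ (λ t → not (any (λ s → (s ⊆ᵇ t) ∧ not (t ⊆ᵇ s)) ts)) ts)

𝓜 : ∀ {n} → Expr n → List (Term n)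
𝓜 φ = absorb (map (deduplicateᵇ _==ˡ_) (dnf true φ))

MEqualsB : ∀ {n} → Expr n → Set
MEqualsB φ =
  (∀ t → t ∈ 𝓜 φ → PrimeImplicant φ t) ×
  (∀ γ → PrimeImplicant φ γ → Σ (Term _) λ t → (t ∈ 𝓜 φ) × SameTerm t γ)

-- The map Ẑ → {0, ½, 1} sending x to 1 if x ≥ m, to 0 if x ≤ -m and to ½ otherwise is a
-- homomorphism onto Kleene's three-valued logic K₃.  With m = |⟦ψ⟧ᵥ|, the theorem reduces to:
-- a K₃-valuation w giving ψ a classical value gives φ the same value.  Over K₃, φ evaluates like
-- its DNF, whose terms contain, and are contained in, the terms of 𝓜(φ) = 𝓑(φ).  If ψ(w) = 1,
-- every Boolean completion of w satisfies ψ, so the literals made true by w form an implicant of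
-- φ; a prime implicant inside it is a DNF term of value 1.  If ψ(w) = 0, a prime implicant with
-- no literal of value 0 would be satisfied by some completion of w, at which ψ would be both
-- true and false; so every DNF term has value 0.
module Submission where

open import Defs
open import Data.Bool using (Bool; true; false; not; _∧_; _∨_; if_then_else_; T)
open import Data.Bool.Properties using (_≟_; ∧-conicalˡ; ∧-conicalʳ; T-≡; T-∧)
open import Data.Bool.ListAction using (any)
open import Data.Fin using (Fin; zero; suc)
open import Data.Fin.Properties using () renaming (_≟_ to _≟ᶠ_)
open import Data.List using (List; []; _∷_; _++_; map; concatMap; filter;
  deduplicateᵇ; length; allFin; cartesianProduct)
open import Data.List.Membership.Propositional using (_∈_; _∉_; lose; find)
open import Data.List.Membership.Propositional.Properties
  using (∈-filter⁺; ∈-filter⁻; ∈-map⁺; ∈-map⁻; ∈-deduplicate⁻; ∈-allFin; ∈-cartesianProduct⁺)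
import Data.List.Membership.DecPropositional as DecMembership
open import Data.List.Properties using (filter-notAll)
open import Data.List.Relation.Binary.Subset.Propositional.Properties using (⊆-refl; ⊆-trans; Any-resp-⊆)
open import Data.List.Relation.Unary.All as All using (All; []; _∷_)
open import Data.List.Relation.Unary.All.Properties using (all⁺; all⁻; ¬Any⇒All¬)
open import Data.List.Relation.Unary.Any as Any using (Any; here; there; any?)
open import Data.List.Relation.Unary.Any.Properties using (any⁺; any⁻; deduplicate⁺)
open import Data.Nat using (ℕ; zero; suc; _≤_; _<_; _≤?_)
open import Data.Nat.Induction using (<-wellFounded)
import Data.Nat.Properties as ℕ
open import Data.Product using (Σ; _×_; _,_; proj₁; proj₂)
open import Data.Product.Properties using (≡-dec)
open import Data.Sum using (_⊎_; inj₁; inj₂; map₂)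
open import Data.Vec.Functional using (head; tail) renaming (_∷_ to _◂_)
open import Function using (_∘_; _⇔_; id; case_of_)
open import Function.Bundles using (Equivalence; mk⇔)
open import Induction.WellFounded using (Acc; acc)
open import Relation.Binary using (Rel; Reflexive; Transitive; Decidable; DecidableEquality)
open import Relation.Binary.PropositionalEquality
  using (_≡_; _≢_; refl; sym; trans; cong; cong₂; subst; _≗_; module ≡-Reasoning)
open import Relation.Nullary using (¬_; Dec; yes; no; does; contradiction)
open import Relation.Nullary.Decidable
  using (map′; _×-dec_; _→-dec_; ¬?; dec-true; dec-false; decidable-stable; T?)

¬T⇒T-not : ∀ {b} → ¬ T b → T (not b)
¬T⇒T-not {true}  ¬t = ¬t _
¬T⇒T-not {false} _  = _

T-not⇒¬T : ∀ {b} → T (not b) → ¬ T b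
T-not⇒¬T {true} ()

==⇒≡ : ∀ {a b} → T (a == b) → a ≡ b
==⇒≡ {true}  {true}  _ = refl
==⇒≡ {false} {false} _ = refl

==-refl : ∀ a → (a == a) ≡ true
==-refl true  = refl
==-refl false = refl

module MinimalElement {a ℓ} {A : Set a} {_≤_ : Rel A ℓ}
  (≤-refl : Reflexive _≤_) (≤-trans : Transitive _≤_) (_≤?_ : Decidable _≤_) where

  _⊏_ : Rel A ℓ
  x ⊏ y = x ≤ y × ¬ y ≤ x

  _⊏?_ : Decidable _⊏_
  x ⊏? y = x ≤? y ×-dec ¬? (y ≤? x)

  -- The candidate only ever decreases, so an element skipped earlier stays not below it.
  minimal-below : ∀ x ys → Σ A λ m → m ≤ x × (m ≡ x ⊎ m ∈ ys) × All (λ y → ¬ y ⊏ m) ys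
  minimal-below x [] = x , ≤-refl , inj₁ refl , []
  minimal-below x (y ∷ ys) with y ⊏? x
  ... | yes (y≤x , _) =
    let m , m≤y , m∈ , ys⋤m = minimal-below y ys
    in  m , ≤-trans m≤y y≤x , inj₂ (from-y m∈) , (λ y⊏m → proj₂ y⊏m m≤y) ∷ ys⋤m
    where
    from-y : ∀ {m} → m ≡ y ⊎ m ∈ ys → m ∈ y ∷ ys
    from-y (inj₁ refl) = here refl
    from-y (inj₂ m∈ys) = there m∈ys
  ... | no y⋤x =
    let m , m≤x , m∈ , ys⋤m = minimal-below x ys
    in  m , m≤x , map₂ there m∈ ,
        (λ (y≤m , m≰y) → y⋤x (≤-trans y≤m m≤x , λ x≤y → m≰y (≤-trans m≤x x≤y))) ∷ ys⋤m

  minimal-in : ∀ {x xs} → x ∈ xs → Σ A λ m → m ≤ x × m ∈ xs × All (λ y → ¬ y ⊏ m) xs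
  minimal-in {x} {xs} x∈xs with minimal-below x xs
  ... | m , m≤x , inj₁ refl , xs⋤m = m , m≤x , x∈xs , xs⋤m
  ... | m , m≤x , inj₂ m∈xs , xs⋤m = m , m≤x , m∈xs , xs⋤m

-- Literals, terms and implicants

∀-valuation? : ∀ {n} {P : (Fin n → Bool) → Set} →
  (∀ {u u′} → u ≗ u′ → P u → P u′) → (∀ u → Dec (P u)) → Dec (∀ u → P u)
∀-valuation? {zero}  resp P? = map′ (λ p u → resp (λ ()) p) (λ ∀P → ∀P u₀) (P? u₀)
  where
  u₀ : Fin 0 → Bool
  u₀ ()
∀-valuation? {suc n} {P} resp P? =
  map′ from-halves (λ ∀P → (λ u → ∀P (true ◂ u)) , (λ u → ∀P (false ◂ u)))
       (∀-valuation? (resp ∘ ◂-cong) (P? ∘ (true ◂_))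
          ×-dec ∀-valuation? (resp ∘ ◂-cong) (P? ∘ (false ◂_)))
  where
  ◂-cong : ∀ {b} {u u′ : Fin n → Bool} → u ≗ u′ → (b ◂ u) ≗ (b ◂ u′)
  ◂-cong u≗u′ zero    = refl
  ◂-cong u≗u′ (suc i) = u≗u′ i
  head◂tail : (u : Fin (suc n) → Bool) → (head u ◂ tail u) ≗ u
  head◂tail u zero    = refl
  head◂tail u (suc i) = refl
  from-halves : (∀ u → P (true ◂ u)) × (∀ u → P (false ◂ u)) → ∀ u → P u
  from-halves (P-true , P-false) u = resp (head◂tail u) (by-head (head u))
    where
    by-head : ∀ b → P (b ◂ tail u)
    by-head true  = P-true (tail u)
    by-head false = P-false (tail u)

module _ {n : ℕ} where

  _≟ˡ_ : DecidableEquality (Literal n)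
  _≟ˡ_ = ≡-dec _≟ᶠ_ _≟_

  open DecMembership _≟ˡ_ using (_∈?_)

  ==ˡ⇒≡ : ∀ {l l′ : Literal n} → T (l ==ˡ l′) → l ≡ l′
  ==ˡ⇒≡ {i , p} {j , q} eq with i ≟ᶠ j
  ... | yes refl = cong (i ,_) (==⇒≡ eq)

  ==ˡ-refl : ∀ (l : Literal n) → T (l ==ˡ l)
  ==ˡ-refl (i , p) rewrite dec-true (i ≟ᶠ i) refl | ==-refl p = _

  ∈⇔any-==ˡ : ∀ {l} {t : Term n} → l ∈ t ⇔ T (any (l ==ˡ_) t)
  ∈⇔any-==ˡ {l} {t} = mk⇔
    (any⁺ (l ==ˡ_) ∘ Any.map (λ { refl → ==ˡ-refl l }))
    (Any.map ==ˡ⇒≡ ∘ any⁻ (l ==ˡ_) t)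

  ⊆ᵇ⇔Subterm : ∀ (s t : Term n) → T (s ⊆ᵇ t) ⇔ Subterm s t
  ⊆ᵇ⇔Subterm s t = mk⇔ sound complete
    where
    sound : T (s ⊆ᵇ t) → Subterm s t
    sound s⊆ᵇt = Equivalence.from ∈⇔any-==ˡ ∘ All.lookup (all⁺ (λ l → any (l ==ˡ_) t) s s⊆ᵇt)
    complete : Subterm s t → T (s ⊆ᵇ t)
    complete s⊆t = all⁻ (λ l → any (l ==ˡ_) t) (All.tabulate (Equivalence.to ∈⇔any-==ˡ ∘ s⊆t))

  Contradictory-⊆ : ∀ {δ γ : Term n} → Subterm δ γ → Contradictory δ → Contradictory γ
  Contradictory-⊆ δ⊆γ (i , x∈δ , x̄∈δ) = i , δ⊆γ x∈δ , δ⊆γ x̄∈δ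

  _⊨ˡ_ : (Fin n → Bool) → Literal n → Set
  u ⊨ˡ (i , p) = u i ≡ p

  ⟦⟧ᵀ-sound : ∀ {u} (t : Term n) → ⟦ t ⟧ᵀ u ≡ true → All (u ⊨ˡ_) t
  ⟦⟧ᵀ-sound []            _ = []
  ⟦⟧ᵀ-sound {u} ((i , p) ∷ t) h =
    ==⇒≡ (Equivalence.from T-≡ (∧-conicalˡ _ _ h)) ∷ ⟦⟧ᵀ-sound t (∧-conicalʳ (u i == p) _ h)

  ⟦⟧ᵀ-complete : ∀ {u} {t : Term n} → All (u ⊨ˡ_) t → ⟦ t ⟧ᵀ u ≡ true
  ⟦⟧ᵀ-complete []                            = refl
  ⟦⟧ᵀ-complete {u} {(i , p) ∷ _} (refl ∷ ps) rewrite ==-refl (u i) = ⟦⟧ᵀ-complete ps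

  ⟦⟧ᵀ-cong : ∀ {u u′} → u ≗ u′ → (t : Term n) → ⟦ t ⟧ᵀ u ≡ ⟦ t ⟧ᵀ u′
  ⟦⟧ᵀ-cong u≗u′ []            = refl
  ⟦⟧ᵀ-cong u≗u′ ((i , p) ∷ t) = cong₂ _∧_ (cong (_== p) (u≗u′ i)) (⟦⟧ᵀ-cong u≗u′ t)

  ⟦⟧ᴮ-cong : ∀ {u u′} → u ≗ u′ → (e : Expr n) → ⟦ e ⟧ᴮ u ≡ ⟦ e ⟧ᴮ u′
  ⟦⟧ᴮ-cong u≗u′ (var i)  = u≗u′ i
  ⟦⟧ᴮ-cong u≗u′ (a ∧ₑ b) = cong₂ _∧_ (⟦⟧ᴮ-cong u≗u′ a) (⟦⟧ᴮ-cong u≗u′ b)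
  ⟦⟧ᴮ-cong u≗u′ (a ∨ₑ b) = cong₂ _∨_ (⟦⟧ᴮ-cong u≗u′ a) (⟦⟧ᴮ-cong u≗u′ b)
  ⟦⟧ᴮ-cong u≗u′ (¬ₑ a)   = cong not (⟦⟧ᴮ-cong u≗u′ a)

  Implicant-⊆ : ∀ {φ : Expr n} {δ γ} → Implicant φ δ → Subterm δ γ → Implicant φ γ
  Implicant-⊆ {γ = γ} δ-imp δ⊆γ u γ-true =
    δ-imp u (⟦⟧ᵀ-complete (All.tabulate (All.lookup (⟦⟧ᵀ-sound {u} γ γ-true) ∘ δ⊆γ)))

  Implicant? : (φ : Expr n) (δ : Term n) → Dec (Implicant φ δ)
  Implicant? φ δ = ∀-valuation? resp (λ u → (⟦ δ ⟧ᵀ u ≟ true) →-dec (⟦ φ ⟧ᴮ u ≟ true))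
    where
    resp : ∀ {u u′} → u ≗ u′ →
      (⟦ δ ⟧ᵀ u ≡ true → ⟦ φ ⟧ᴮ u ≡ true) → ⟦ δ ⟧ᵀ u′ ≡ true → ⟦ φ ⟧ᴮ u′ ≡ true
    resp u≗u′ imp δ-true = trans (sym (⟦⟧ᴮ-cong u≗u′ φ)) (imp (trans (⟦⟧ᵀ-cong u≗u′ δ) δ-true))

  _∖_ : Term n → Literal n → Term n
  γ ∖ l = filter (¬? ∘ (l ≟ˡ_)) γ

  ∖-⊆ : ∀ γ l → Subterm (γ ∖ l) γ
  ∖-⊆ γ l = proj₁ ∘ ∈-filter⁻ (¬? ∘ (l ≟ˡ_))

  ∖-shorter : ∀ {γ l} → l ∈ γ → length (γ ∖ l) < length γ
  ∖-shorter {γ} l∈γ = filter-notAll (¬? ∘ (_ ≟ˡ_)) γ (Any.map (λ l≡ l≢ → l≢ l≡) l∈γ)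

  ⊆-∖ : ∀ {δ γ l} → Subterm δ γ → l ∉ δ → Subterm δ (γ ∖ l)
  ⊆-∖ δ⊆γ l∉δ x∈δ = ∈-filter⁺ (¬? ∘ (_ ≟ˡ_)) (δ⊆γ x∈δ) (λ { refl → l∉δ x∈δ })

  prime-implicant-⊆ : ∀ (φ : Expr n) {γ} → ¬ Contradictory γ → Implicant φ γ →
    Σ (Term n) λ δ → PrimeImplicant φ δ × Subterm δ γ
  prime-implicant-⊆ φ {γ} = go γ (<-wellFounded (length γ))
    where
    go : ∀ γ → Acc _<_ (length γ) → ¬ Contradictory γ → Implicant φ γ →
      Σ (Term n) λ δ → PrimeImplicant φ δ × Subterm δ γ
    go γ (acc shorter) γ-consistent γ-imp with any? (λ l → Implicant? φ (γ ∖ l)) γ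
    ... | yes removable =
      let l , l∈γ , imp = find removable
          δ , δ-prime , δ⊆ = go (γ ∖ l) (shorter (∖-shorter l∈γ))
                                (γ-consistent ∘ Contradictory-⊆ (∖-⊆ γ l)) imp
      in  δ , δ-prime , ∖-⊆ γ l ∘ δ⊆
    ... | no irremovable = γ , (γ-consistent , γ-imp , minimal) , id
      where
      minimal : ∀ δ → ProperSubterm δ γ → ¬ Implicant φ δ
      minimal δ (δ⊆γ , γ⊈δ) δ-imp = γ⊈δ λ {l} l∈γ →
        decidable-stable (l ∈? δ) λ l∉δ →
          irremovable (lose l∈γ (Implicant-⊆ {φ = φ} δ-imp (⊆-∖ δ⊆γ l∉δ)))

  -- The De Morgan canonical form against the raw DNF

  Subterm? : Decidable (Subterm {n})
  Subterm? s t = map′ (Equivalence.to (⊆ᵇ⇔Subterm s t)) (Equivalence.from (⊆ᵇ⇔Subterm s t))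
                      (T? (s ⊆ᵇ t))

  open MinimalElement {_≤_ = Subterm} ⊆-refl ⊆-trans Subterm?

  -- absorb ts = deduplicate (T? ∘₂ _≈ᵇ_) (filter (T? ∘ unabsorbed ts) ts)
  _⊂ᵇ_ _≈ᵇ_ : Term n → Term n → Bool
  s ⊂ᵇ t = (s ⊆ᵇ t) ∧ not (t ⊆ᵇ s)
  s ≈ᵇ t = (s ⊆ᵇ t) ∧ (t ⊆ᵇ s)

  unabsorbed : List (Term n) → Term n → Bool
  unabsorbed ts t = not (any (_⊂ᵇ t) ts)

  ∈-absorb⁻ : ∀ {ts t} → t ∈ absorb ts → t ∈ ts
  ∈-absorb⁻ {ts} = proj₁ ∘ ∈-filter⁻ (T? ∘ unabsorbed ts) ∘ ∈-deduplicate⁻ (λ s t → T? (s ≈ᵇ t)) _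

  -- A ⊆-minimal term survives the filter of absorb; deduplication keeps one set-equal to it.
  ∈-absorb⁺ : ∀ {ts s} → s ∈ ts → Σ (Term n) λ t → t ∈ absorb ts × Subterm t s
  ∈-absorb⁺ {ts} s∈ts with minimal-in s∈ts
  ... | m , m⊆s , m∈ts , ts⋤m =
    let t , t∈ , t⊆m = find (deduplicate⁺ (λ x y → T? (x ≈ᵇ y)) (λ {x y} → resp {x} {y})
                               (lose (∈-filter⁺ (T? ∘ unabsorbed ts) m∈ts survives) ⊆-refl))
    in  t , t∈ , m⊆s ∘ t⊆m
    where
    survives : T (unabsorbed ts m)
    survives = ¬T⇒T-not λ some →
      let r , r∈ts , r⊂m = find (any⁻ (_⊂ᵇ m) ts some)
          r⊆ᵇm , m⊈ᵇr = Equivalence.to T-∧ r⊂m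
      in  All.lookup ts⋤m r∈ts
            (Equivalence.to (⊆ᵇ⇔Subterm r m) r⊆ᵇm , T-not⇒¬T m⊈ᵇr ∘ Equivalence.from (⊆ᵇ⇔Subterm m r))
    resp : ∀ {x y} → T (y ≈ᵇ x) → Subterm x m → Subterm y m
    resp {x} {y} y≈x x⊆m = x⊆m ∘ Equivalence.to (⊆ᵇ⇔Subterm y x) (proj₁ (Equivalence.to T-∧ y≈x))

  ⊆-deduplicateˡ : ∀ (s : Term n) → Subterm s (deduplicateᵇ _==ˡ_ s)
  ⊆-deduplicateˡ s {l} =
    deduplicate⁺ (λ x y → T? (x ==ˡ y)) (λ y==x l≡x → trans l≡x (sym (==ˡ⇒≡ y==x)))

  deduplicateˡ-⊆ : ∀ (s : Term n) → Subterm (deduplicateᵇ _==ˡ_ s) s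
  deduplicateˡ-⊆ s = ∈-deduplicate⁻ (λ x y → T? (x ==ˡ y)) s

  ∈-𝓜⁻ : ∀ {φ : Expr n} {t} → t ∈ 𝓜 φ → Σ (Term n) λ s → s ∈ dnf true φ × Subterm s t
  ∈-𝓜⁻ t∈𝓜 with s , s∈dnf , refl ← ∈-map⁻ (deduplicateᵇ _==ˡ_) (∈-absorb⁻ t∈𝓜) =
    s , s∈dnf , ⊆-deduplicateˡ s

  ∈-𝓜⁺ : ∀ {φ : Expr n} {s} → s ∈ dnf true φ → Σ (Term n) λ t → t ∈ 𝓜 φ × Subterm t s
  ∈-𝓜⁺ {s = s} s∈dnf with t , t∈𝓜 , t⊆ ← ∈-absorb⁺ (∈-map⁺ (deduplicateᵇ _==ˡ_) s∈dnf) =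
    t , t∈𝓜 , deduplicateˡ-⊆ s ∘ t⊆

-- Kleene's three-valued logic

data K₃ : Set where
  0ₖ ½ₖ 1ₖ : K₃

known : Bool → K₃
known true  = 1ₖ
known false = 0ₖ

_≟ₖ_ : DecidableEquality K₃
0ₖ ≟ₖ 0ₖ = yes refl
½ₖ ≟ₖ ½ₖ = yes refl
1ₖ ≟ₖ 1ₖ = yes refl
0ₖ ≟ₖ ½ₖ = no λ ()
0ₖ ≟ₖ 1ₖ = no λ ()
½ₖ ≟ₖ 0ₖ = no λ ()
½ₖ ≟ₖ 1ₖ = no λ ()
1ₖ ≟ₖ 0ₖ = no λ ()
1ₖ ≟ₖ ½ₖ = no λ ()

infix  8 ¬ₖ_
infixr 7 _⊓_
infixr 6 _⊔_
infix  4 _⊑_ _≤ₖ_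

_⊓_ : K₃ → K₃ → K₃
0ₖ ⊓ _  = 0ₖ
1ₖ ⊓ y  = y
½ₖ ⊓ 0ₖ = 0ₖ
½ₖ ⊓ _  = ½ₖ

_⊔_ : K₃ → K₃ → K₃
1ₖ ⊔ _  = 1ₖ
0ₖ ⊔ y  = y
½ₖ ⊔ 1ₖ = 1ₖ
½ₖ ⊔ _  = ½ₖ

¬ₖ_ : K₃ → K₃
¬ₖ 0ₖ = 1ₖ
¬ₖ ½ₖ = ½ₖ
¬ₖ 1ₖ = 0ₖ

open import Algebra.Definitions (_≡_ {A = K₃})
  using (Commutative; Associative; _DistributesOverˡ_; _DistributesOverʳ_; RightIdentity; RightZero; Involutive)

⊓-identityʳ : RightIdentity 1ₖ _⊓_
⊓-identityʳ 0ₖ = refl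
⊓-identityʳ ½ₖ = refl
⊓-identityʳ 1ₖ = refl

⊓-zeroʳ : RightZero 0ₖ _⊓_
⊓-zeroʳ 0ₖ = refl
⊓-zeroʳ ½ₖ = refl
⊓-zeroʳ 1ₖ = refl

⊔-identityʳ : RightIdentity 0ₖ _⊔_
⊔-identityʳ 0ₖ = refl
⊔-identityʳ ½ₖ = refl
⊔-identityʳ 1ₖ = refl

⊔-zeroʳ : RightZero 1ₖ _⊔_
⊔-zeroʳ 0ₖ = refl
⊔-zeroʳ ½ₖ = refl
⊔-zeroʳ 1ₖ = refl

⊓-comm : Commutative _⊓_
⊓-comm 0ₖ y  = sym (⊓-zeroʳ y)
⊓-comm 1ₖ y  = sym (⊓-identityʳ y)
⊓-comm ½ₖ 0ₖ = refl
⊓-comm ½ₖ ½ₖ = refl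
⊓-comm ½ₖ 1ₖ = refl

⊔-comm : Commutative _⊔_
⊔-comm 0ₖ y  = sym (⊔-identityʳ y)
⊔-comm 1ₖ y  = sym (⊔-zeroʳ y)
⊔-comm ½ₖ 0ₖ = refl
⊔-comm ½ₖ ½ₖ = refl
⊔-comm ½ₖ 1ₖ = refl

⊓-assoc : Associative _⊓_
⊓-assoc 0ₖ _  _  = refl
⊓-assoc 1ₖ _  _  = refl
⊓-assoc ½ₖ 0ₖ _  = refl
⊓-assoc ½ₖ ½ₖ 0ₖ = refl
⊓-assoc ½ₖ ½ₖ ½ₖ = refl
⊓-assoc ½ₖ ½ₖ 1ₖ = refl
⊓-assoc ½ₖ 1ₖ _  = refl

⊔-assoc : Associative _⊔_
⊔-assoc 1ₖ _  _  = refl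
⊔-assoc 0ₖ _  _  = refl
⊔-assoc ½ₖ 1ₖ _  = refl
⊔-assoc ½ₖ ½ₖ 0ₖ = refl
⊔-assoc ½ₖ ½ₖ ½ₖ = refl
⊔-assoc ½ₖ ½ₖ 1ₖ = refl
⊔-assoc ½ₖ 0ₖ _  = refl

⊓-distribˡ-⊔ : _⊓_ DistributesOverˡ _⊔_
⊓-distribˡ-⊔ 0ₖ _  _  = refl
⊓-distribˡ-⊔ 1ₖ _  _  = refl
⊓-distribˡ-⊔ ½ₖ 0ₖ _  = refl
⊓-distribˡ-⊔ ½ₖ ½ₖ 0ₖ = refl
⊓-distribˡ-⊔ ½ₖ ½ₖ ½ₖ = refl
⊓-distribˡ-⊔ ½ₖ ½ₖ 1ₖ = refl
⊓-distribˡ-⊔ ½ₖ 1ₖ 0ₖ = refl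
⊓-distribˡ-⊔ ½ₖ 1ₖ ½ₖ = refl
⊓-distribˡ-⊔ ½ₖ 1ₖ 1ₖ = refl

⊓-distribʳ-⊔ : _⊓_ DistributesOverʳ _⊔_
⊓-distribʳ-⊔ x y z = begin
  (y ⊔ z) ⊓ x        ≡⟨ ⊓-comm (y ⊔ z) x ⟩
  x ⊓ (y ⊔ z)        ≡⟨ ⊓-distribˡ-⊔ x y z ⟩
  x ⊓ y ⊔ x ⊓ z      ≡⟨ cong₂ _⊔_ (⊓-comm x y) (⊓-comm x z) ⟩
  y ⊓ x ⊔ z ⊓ x      ∎
  where open ≡-Reasoning

¬ₖ-involutive : Involutive ¬ₖ_
¬ₖ-involutive 0ₖ = refl
¬ₖ-involutive ½ₖ = refl
¬ₖ-involutive 1ₖ = refl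

¬ₖ-⊓ : ∀ x y → ¬ₖ (x ⊓ y) ≡ ¬ₖ x ⊔ ¬ₖ y
¬ₖ-⊓ 0ₖ _  = refl
¬ₖ-⊓ 1ₖ _  = refl
¬ₖ-⊓ ½ₖ 0ₖ = refl
¬ₖ-⊓ ½ₖ ½ₖ = refl
¬ₖ-⊓ ½ₖ 1ₖ = refl

¬ₖ-⊔ : ∀ x y → ¬ₖ (x ⊔ y) ≡ ¬ₖ x ⊓ ¬ₖ y
¬ₖ-⊔ 0ₖ _  = refl
¬ₖ-⊔ 1ₖ _  = refl
¬ₖ-⊔ ½ₖ 0ₖ = refl
¬ₖ-⊔ ½ₖ ½ₖ = refl
¬ₖ-⊔ ½ₖ 1ₖ = refl

data _⊑_ : K₃ → Bool → Set where
  0⊑ : 0ₖ ⊑ false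
  ½⊑ : ∀ {b} → ½ₖ ⊑ b
  1⊑ : 1ₖ ⊑ true

⊓-⊑ : ∀ {x y b c} → x ⊑ b → y ⊑ c → x ⊓ y ⊑ (b ∧ c)
⊓-⊑ 0⊑           _  = 0⊑
⊓-⊑ 1⊑           q  = q
⊓-⊑ (½⊑ {true})  0⊑ = 0⊑
⊓-⊑ (½⊑ {false}) 0⊑ = 0⊑
⊓-⊑ ½⊑           ½⊑ = ½⊑
⊓-⊑ ½⊑           1⊑ = ½⊑

⊔-⊑ : ∀ {x y b c} → x ⊑ b → y ⊑ c → x ⊔ y ⊑ (b ∨ c)
⊔-⊑ 1⊑           _  = 1⊑
⊔-⊑ 0⊑           q  = q
⊔-⊑ (½⊑ {true})  1⊑ = 1⊑
⊔-⊑ (½⊑ {false}) 1⊑ = 1⊑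
⊔-⊑ ½⊑           ½⊑ = ½⊑
⊔-⊑ ½⊑           0⊑ = ½⊑

¬ₖ-⊑ : ∀ {x b} → x ⊑ b → ¬ₖ x ⊑ not b
¬ₖ-⊑ 0⊑ = 1⊑
¬ₖ-⊑ ½⊑ = ½⊑
¬ₖ-⊑ 1⊑ = 0⊑

known-⊑⇒≡ : ∀ {b c} → known b ⊑ c → c ≡ b
known-⊑⇒≡ {true}  1⊑ = refl
known-⊑⇒≡ {false} 0⊑ = refl

½≢known : ∀ {b} → ½ₖ ≢ known b
½≢known {true}  ()
½≢known {false} ()

≡⇒known-⊑ : ∀ {b c} → c ≡ b → known b ⊑ c
≡⇒known-⊑ {true}  refl = 1⊑
≡⇒known-⊑ {false} refl = 0⊑

data _≤ₖ_ : K₃ → K₃ → Set where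
  0≤  : ∀ {x} → 0ₖ ≤ₖ x
  ½≤½ : ½ₖ ≤ₖ ½ₖ
  ≤1  : ∀ {x} → x ≤ₖ 1ₖ

⊓-≤ₖ : ∀ {x y} → x ≤ₖ y → x ⊓ y ≡ x
⊓-≤ₖ 0≤       = refl
⊓-≤ₖ ½≤½      = refl
⊓-≤ₖ (≤1 {x}) = ⊓-identityʳ x

⊔-≤ₖ : ∀ {x y} → x ≤ₖ y → x ⊔ y ≡ y
⊔-≤ₖ 0≤       = refl
⊔-≤ₖ ½≤½      = refl
⊔-≤ₖ (≤1 {x}) = ⊔-zeroʳ x

module _ {n : ℕ} where

  ⟦_⟧³ : Expr n → (Fin n → K₃) → K₃
  ⟦ var i ⟧³  w = w i
  ⟦ a ∧ₑ b ⟧³ w = ⟦ a ⟧³ w ⊓ ⟦ b ⟧³ w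
  ⟦ a ∨ₑ b ⟧³ w = ⟦ a ⟧³ w ⊔ ⟦ b ⟧³ w
  ⟦ ¬ₑ a ⟧³   w = ¬ₖ ⟦ a ⟧³ w

  ⟦_⟧ˡ³ : Literal n → (Fin n → K₃) → K₃
  ⟦ i , true ⟧ˡ³  w = w i
  ⟦ i , false ⟧ˡ³ w = ¬ₖ w i

  ⟦_⟧ᵀ³ : Term n → (Fin n → K₃) → K₃
  ⟦ [] ⟧ᵀ³    w = 1ₖ
  ⟦ l ∷ t ⟧ᵀ³ w = ⟦ l ⟧ˡ³ w ⊓ ⟦ t ⟧ᵀ³ w

  ⟦_⟧ᴰ³ : List (Term n) → (Fin n → K₃) → K₃
  ⟦ [] ⟧ᴰ³     w = 0ₖ
  ⟦ t ∷ ts ⟧ᴰ³ w = ⟦ t ⟧ᵀ³ w ⊔ ⟦ ts ⟧ᴰ³ w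

  polarity : Bool → K₃ → K₃
  polarity true  x = x
  polarity false x = ¬ₖ x

  module _ (w : Fin n → K₃) where

    ⟦++⟧ᵀ³ : ∀ s t → ⟦ s ++ t ⟧ᵀ³ w ≡ ⟦ s ⟧ᵀ³ w ⊓ ⟦ t ⟧ᵀ³ w
    ⟦++⟧ᵀ³ []      t = refl
    ⟦++⟧ᵀ³ (l ∷ s) t =
      trans (cong (⟦ l ⟧ˡ³ w ⊓_) (⟦++⟧ᵀ³ s t)) (sym (⊓-assoc (⟦ l ⟧ˡ³ w) (⟦ s ⟧ᵀ³ w) (⟦ t ⟧ᵀ³ w)))

    ⟦++⟧ᴰ³ : ∀ ss ts → ⟦ ss ++ ts ⟧ᴰ³ w ≡ ⟦ ss ⟧ᴰ³ w ⊔ ⟦ ts ⟧ᴰ³ w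
    ⟦++⟧ᴰ³ []       ts = refl
    ⟦++⟧ᴰ³ (s ∷ ss) ts =
      trans (cong (⟦ s ⟧ᵀ³ w ⊔_) (⟦++⟧ᴰ³ ss ts)) (sym (⊔-assoc (⟦ s ⟧ᵀ³ w) (⟦ ss ⟧ᴰ³ w) (⟦ ts ⟧ᴰ³ w)))

    ⟦map-++⟧ᴰ³ : ∀ s ts → ⟦ map (s ++_) ts ⟧ᴰ³ w ≡ ⟦ s ⟧ᵀ³ w ⊓ ⟦ ts ⟧ᴰ³ w
    ⟦map-++⟧ᴰ³ s []       = sym (⊓-zeroʳ _)
    ⟦map-++⟧ᴰ³ s (t ∷ ts) = begin
      ⟦ s ++ t ⟧ᵀ³ w ⊔ ⟦ map (s ++_) ts ⟧ᴰ³ w     ≡⟨ cong₂ _⊔_ (⟦++⟧ᵀ³ s t) (⟦map-++⟧ᴰ³ s ts) ⟩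
      ⟦ s ⟧ᵀ³ w ⊓ ⟦ t ⟧ᵀ³ w ⊔ ⟦ s ⟧ᵀ³ w ⊓ ⟦ ts ⟧ᴰ³ w ≡⟨ ⊓-distribˡ-⊔ (⟦ s ⟧ᵀ³ w) (⟦ t ⟧ᵀ³ w) (⟦ ts ⟧ᴰ³ w) ⟨
      ⟦ s ⟧ᵀ³ w ⊓ (⟦ t ⟧ᵀ³ w ⊔ ⟦ ts ⟧ᴰ³ w)         ∎
      where open ≡-Reasoning

    ⟦products⟧ᴰ³ : ∀ ss ts → ⟦ concatMap (λ s → map (s ++_) ts) ss ⟧ᴰ³ w ≡ ⟦ ss ⟧ᴰ³ w ⊓ ⟦ ts ⟧ᴰ³ w
    ⟦products⟧ᴰ³ []       ts = refl
    ⟦products⟧ᴰ³ (s ∷ ss) ts = begin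
      ⟦ map (s ++_) ts ++ concatMap (λ s → map (s ++_) ts) ss ⟧ᴰ³ w
        ≡⟨ ⟦++⟧ᴰ³ (map (s ++_) ts) _ ⟩
      ⟦ map (s ++_) ts ⟧ᴰ³ w ⊔ ⟦ concatMap (λ s → map (s ++_) ts) ss ⟧ᴰ³ w
        ≡⟨ cong₂ _⊔_ (⟦map-++⟧ᴰ³ s ts) (⟦products⟧ᴰ³ ss ts) ⟩
      ⟦ s ⟧ᵀ³ w ⊓ ⟦ ts ⟧ᴰ³ w ⊔ ⟦ ss ⟧ᴰ³ w ⊓ ⟦ ts ⟧ᴰ³ w
        ≡⟨ ⊓-distribʳ-⊔ (⟦ ts ⟧ᴰ³ w) (⟦ s ⟧ᵀ³ w) (⟦ ss ⟧ᴰ³ w) ⟨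
      (⟦ s ⟧ᵀ³ w ⊔ ⟦ ss ⟧ᴰ³ w) ⊓ ⟦ ts ⟧ᴰ³ w ∎
      where open ≡-Reasoning

    ⟦dnf⟧³ : ∀ p (e : Expr n) → ⟦ dnf p e ⟧ᴰ³ w ≡ polarity p (⟦ e ⟧³ w)
    ⟦dnf⟧³ true  (var i)  = trans (⊔-identityʳ _) (⊓-identityʳ (w i))
    ⟦dnf⟧³ false (var i)  = trans (⊔-identityʳ _) (⊓-identityʳ (¬ₖ w i))
    ⟦dnf⟧³ true  (a ∧ₑ b) = trans (⟦products⟧ᴰ³ (dnf true a) (dnf true b))
                                  (cong₂ _⊓_ (⟦dnf⟧³ true a) (⟦dnf⟧³ true b))
    ⟦dnf⟧³ false (a ∧ₑ b) = trans (⟦++⟧ᴰ³ (dnf false a) (dnf false b))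
                                  (trans (cong₂ _⊔_ (⟦dnf⟧³ false a) (⟦dnf⟧³ false b))
                                         (sym (¬ₖ-⊓ (⟦ a ⟧³ w) (⟦ b ⟧³ w))))
    ⟦dnf⟧³ true  (a ∨ₑ b) = trans (⟦++⟧ᴰ³ (dnf true a) (dnf true b))
                                  (cong₂ _⊔_ (⟦dnf⟧³ true a) (⟦dnf⟧³ true b))
    ⟦dnf⟧³ false (a ∨ₑ b) = trans (⟦products⟧ᴰ³ (dnf false a) (dnf false b))
                                  (trans (cong₂ _⊓_ (⟦dnf⟧³ false a) (⟦dnf⟧³ false b))
                                         (sym (¬ₖ-⊔ (⟦ a ⟧³ w) (⟦ b ⟧³ w))))
    ⟦dnf⟧³ true  (¬ₑ a)   = ⟦dnf⟧³ false a
    ⟦dnf⟧³ false (¬ₑ a)   = trans (⟦dnf⟧³ true a) (sym (¬ₖ-involutive _))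

    ⟦⟧ᵀ³-1 : ∀ {t} → All (λ l → ⟦ l ⟧ˡ³ w ≡ 1ₖ) t → ⟦ t ⟧ᵀ³ w ≡ 1ₖ
    ⟦⟧ᵀ³-1 []         = refl
    ⟦⟧ᵀ³-1 (p ∷ ps) rewrite p = ⟦⟧ᵀ³-1 ps

    ⟦⟧ᵀ³-0 : ∀ {t} → Any (λ l → ⟦ l ⟧ˡ³ w ≡ 0ₖ) t → ⟦ t ⟧ᵀ³ w ≡ 0ₖ
    ⟦⟧ᵀ³-0 (here p) rewrite p = refl
    ⟦⟧ᵀ³-0 {l ∷ _} (there ps) rewrite ⟦⟧ᵀ³-0 ps = ⊓-zeroʳ (⟦ l ⟧ˡ³ w)

    ⟦⟧ᴰ³-1 : ∀ {ts} → Any (λ t → ⟦ t ⟧ᵀ³ w ≡ 1ₖ) ts → ⟦ ts ⟧ᴰ³ w ≡ 1ₖ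
    ⟦⟧ᴰ³-1 (here p) rewrite p = refl
    ⟦⟧ᴰ³-1 {t ∷ _} (there ps) rewrite ⟦⟧ᴰ³-1 ps = ⊔-zeroʳ (⟦ t ⟧ᵀ³ w)

    ⟦⟧ᴰ³-0 : ∀ {ts} → All (λ t → ⟦ t ⟧ᵀ³ w ≡ 0ₖ) ts → ⟦ ts ⟧ᴰ³ w ≡ 0ₖ
    ⟦⟧ᴰ³-0 []         = refl
    ⟦⟧ᴰ³-0 (p ∷ ps) rewrite p = ⟦⟧ᴰ³-0 ps

  _⊑ᵛ_ : (Fin n → K₃) → (Fin n → Bool) → Set
  w ⊑ᵛ u = ∀ i → w i ⊑ u i

  ⟦⟧³-⊑ : ∀ {w u} → w ⊑ᵛ u → ∀ e → ⟦ e ⟧³ w ⊑ ⟦ e ⟧ᴮ u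
  ⟦⟧³-⊑ w⊑u (var i)  = w⊑u i
  ⟦⟧³-⊑ w⊑u (a ∧ₑ b) = ⊓-⊑ (⟦⟧³-⊑ w⊑u a) (⟦⟧³-⊑ w⊑u b)
  ⟦⟧³-⊑ w⊑u (a ∨ₑ b) = ⊔-⊑ (⟦⟧³-⊑ w⊑u a) (⟦⟧³-⊑ w⊑u b)
  ⟦⟧³-⊑ w⊑u (¬ₑ a)   = ¬ₖ-⊑ (⟦⟧³-⊑ w⊑u a)

  ⟦⟧ᴮ-completion : ∀ {w u b} (e : Expr n) → ⟦ e ⟧³ w ≡ known b → w ⊑ᵛ u → ⟦ e ⟧ᴮ u ≡ b
  ⟦⟧ᴮ-completion e e≡b w⊑u = known-⊑⇒≡ (subst (_⊑ _) e≡b (⟦⟧³-⊑ w⊑u e))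

-- Thresholding Ẑ at a magnitude is a homomorphism onto K₃

≤?⇒≤ : ∀ {m k} → does (m ≤? k) ≡ true → m ≤ k
≤?⇒≤ {m} {k} h = ℕ.≤ᵇ⇒≤ m k (Equivalence.from T-≡ h)

≤ᵐᵇ⇒≤ᵐ : ∀ {a b} → (a ≤ᵐᵇ b) ≡ true → a ≤ᵐ b
≤ᵐᵇ⇒≤ᵐ {fin _} {fin _} h = fin≤fin (≤?⇒≤ h)
≤ᵐᵇ⇒≤ᵐ {fin _} {∞}     _ = _ ≤∞
≤ᵐᵇ⇒≤ᵐ {∞}     {∞}     _ = ∞ ≤∞

≤ᵐᵇ-refl : ∀ a → (a ≤ᵐᵇ a) ≡ true
≤ᵐᵇ-refl (fin m) = dec-true (m ≤? m) ℕ.≤-refl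
≤ᵐᵇ-refl ∞       = refl

≤ᵐᵇ-trans : ∀ a b c → (a ≤ᵐᵇ b) ≡ true → (b ≤ᵐᵇ c) ≡ true → (a ≤ᵐᵇ c) ≡ true
≤ᵐᵇ-trans (fin x) (fin _) (fin z) p q = dec-true (x ≤? z) (ℕ.≤-trans (≤?⇒≤ p) (≤?⇒≤ q))
≤ᵐᵇ-trans (fin _) (fin _) ∞       _ _ = refl
≤ᵐᵇ-trans (fin _) ∞       ∞       _ _ = refl
≤ᵐᵇ-trans ∞       ∞       ∞       _ _ = refl

≤ᵐᵇ-total : ∀ a b → (a ≤ᵐᵇ b) ≡ false → (b ≤ᵐᵇ a) ≡ true
≤ᵐᵇ-total (fin x) (fin y) x≰y =
  dec-true (y ≤? x) (ℕ.≰⇒≥ λ x≤y → contradiction (trans (sym (dec-true (x ≤? y) x≤y)) x≰y) λ ())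
≤ᵐᵇ-total ∞       (fin _) _   = refl

≤ᶻᵇ-total : ∀ x y → (x ≤ᶻᵇ y) ≡ false → (y ≤ᶻᵇ x) ≡ true
≤ᶻᵇ-total (true  · a) (true  · b) x≰y = ≤ᵐᵇ-total a b x≰y
≤ᶻᵇ-total (false · a) (false · b) x≰y = ≤ᵐᵇ-total b a x≰y
≤ᶻᵇ-total (true  · _) (false · _) _   = refl

threshold : Mag → Ẑ → K₃
threshold m (s · a) = if m ≤ᵐᵇ a then known s else ½ₖ

threshold-mono : ∀ m x y → (x ≤ᶻᵇ y) ≡ true → threshold m x ≤ₖ threshold m y
threshold-mono m (true · a) (true · b) a≤b with m ≤ᵐᵇ a in m≤a | m ≤ᵐᵇ b in m≤b
... | true  | true  = ≤1
... | true  | false = case trans (sym (≤ᵐᵇ-trans m a b m≤a a≤b)) m≤b of λ ()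
... | false | true  = ≤1
... | false | false = ½≤½
threshold-mono m (false · a) (false · b) b≤a with m ≤ᵐᵇ a in m≤a | m ≤ᵐᵇ b in m≤b
... | true  | _     = 0≤
... | false | false = ½≤½
... | false | true  = case trans (sym (≤ᵐᵇ-trans m b a m≤b b≤a)) m≤a of λ ()
threshold-mono m (false · a) (true · b) _ with m ≤ᵐᵇ a | m ≤ᵐᵇ b
... | true  | _     = 0≤
... | false | true  = ≤1
... | false | false = ½≤½

threshold-⊓ : ∀ m x y → threshold m (minᶻ x y) ≡ threshold m x ⊓ threshold m y
threshold-⊓ m x y with x ≤ᶻᵇ y in x≤y
... | true  = sym (⊓-≤ₖ (threshold-mono m x y x≤y))
... | false = sym (trans (⊓-comm (threshold m x) (threshold m y))
                        (⊓-≤ₖ (threshold-mono m y x (≤ᶻᵇ-total x y x≤y))))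

threshold-⊔ : ∀ m x y → threshold m (maxᶻ x y) ≡ threshold m x ⊔ threshold m y
threshold-⊔ m x y with x ≤ᶻᵇ y in x≤y
... | true  = sym (⊔-≤ₖ (threshold-mono m x y x≤y))
... | false = sym (trans (⊔-comm (threshold m x) (threshold m y))
                        (⊔-≤ₖ (threshold-mono m y x (≤ᶻᵇ-total x y x≤y))))

threshold-¬ : ∀ m x → threshold m (negᶻ x) ≡ ¬ₖ threshold m x
threshold-¬ m (s · a) with m ≤ᵐᵇ a
... | false = refl
... | true with s
...   | true  = refl
...   | false = refl

threshold-⟦⟧ : ∀ {n} m (e : Expr n) v → threshold m (⟦ e ⟧ᴹ v) ≡ ⟦ e ⟧³ (threshold m ∘ v)
threshold-⟦⟧ m (var i)  v = refl
threshold-⟦⟧ m (a ∧ₑ b) v = trans (threshold-⊓ m (⟦ a ⟧ᴹ v) (⟦ b ⟧ᴹ v))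
                                  (cong₂ _⊓_ (threshold-⟦⟧ m a v) (threshold-⟦⟧ m b v))
threshold-⟦⟧ m (a ∨ₑ b) v = trans (threshold-⊔ m (⟦ a ⟧ᴹ v) (⟦ b ⟧ᴹ v))
                                  (cong₂ _⊔_ (threshold-⟦⟧ m a v) (threshold-⟦⟧ m b v))
threshold-⟦⟧ m (¬ₑ a)   v = trans (threshold-¬ m (⟦ a ⟧ᴹ v)) (cong ¬ₖ_ (threshold-⟦⟧ m a v))

threshold-at-magnitude : ∀ x → threshold ∣ x ∣ᶻ x ≡ known (positive x)
threshold-at-magnitude (s · a) rewrite ≤ᵐᵇ-refl a = refl

threshold-known⇒≤ᵐ : ∀ {m x b} → threshold m x ≡ known b → m ≤ᵐ ∣ x ∣ᶻ
threshold-known⇒≤ᵐ {m} {s · a} h with m ≤ᵐᵇ a in m≤a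
... | true = ≤ᵐᵇ⇒≤ᵐ m≤a
... | false = contradiction h ½≢known

-- Classical values in K₃ transfer from ψ to its canonical equivalent φ

module _ {n : ℕ} where

  open DecMembership (_≟ˡ_ {n}) using (_∈?_)

  allLiterals : List (Literal n)
  allLiterals = cartesianProduct (allFin n) (true ∷ false ∷ [])

  ∈-allLiterals : ∀ l → l ∈ allLiterals
  ∈-allLiterals (i , true)  = ∈-cartesianProduct⁺ (∈-allFin i) (here refl)
  ∈-allLiterals (i , false) = ∈-cartesianProduct⁺ (∈-allFin i) (there (here refl))

  trueLiterals : (Fin n → K₃) → Term n
  trueLiterals w = filter (λ l → ⟦ l ⟧ˡ³ w ≟ₖ 1ₖ) allLiterals

  module _ {w : Fin n → K₃} where

    ∈-trueLiterals⁻ : ∀ {l} → l ∈ trueLiterals w → ⟦ l ⟧ˡ³ w ≡ 1ₖ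
    ∈-trueLiterals⁻ = proj₂ ∘ ∈-filter⁻ (λ l → ⟦ l ⟧ˡ³ w ≟ₖ 1ₖ) {xs = allLiterals}

    ∈-trueLiterals⁺ : ∀ {l} → ⟦ l ⟧ˡ³ w ≡ 1ₖ → l ∈ trueLiterals w
    ∈-trueLiterals⁺ {l} = ∈-filter⁺ (λ l → ⟦ l ⟧ˡ³ w ≟ₖ 1ₖ) (∈-allLiterals l)

    trueLiterals-consistent : ¬ Contradictory (trueLiterals w)
    trueLiterals-consistent (i , x∈ , x̄∈)
      with ∈-trueLiterals⁻ x∈ | ∈-trueLiterals⁻ x̄∈
    ... | wi≡1 | ¬wi≡1 rewrite wi≡1 = case ¬wi≡1 of λ ()

    ⊨trueLiterals⇒⊑ᵛ : ∀ {u} → All (u ⊨ˡ_) (trueLiterals w) → w ⊑ᵛ u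
    ⊨trueLiterals⇒⊑ᵛ u⊨ i with w i in wi
    ... | 1ₖ = ≡⇒known-⊑ (All.lookup u⊨ (∈-trueLiterals⁺ {i , true} wi))
    ... | 0ₖ = ≡⇒known-⊑ (All.lookup u⊨ (∈-trueLiterals⁺ {i , false} (cong ¬ₖ_ wi)))
    ... | ½ₖ = ½⊑

  completeWith : K₃ → Bool → Bool
  completeWith 0ₖ _ = false
  completeWith ½ₖ b = b
  completeWith 1ₖ _ = true

  ⊑-completeWith : ∀ x b → x ⊑ completeWith x b
  ⊑-completeWith 0ₖ _ = 0⊑
  ⊑-completeWith ½ₖ _ = ½⊑
  ⊑-completeWith 1ₖ _ = 1⊑

  satisfying-completion : ∀ w {t : Term n} → ¬ Contradictory t → All (λ l → ⟦ l ⟧ˡ³ w ≢ 0ₖ) t →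
    Σ (Fin n → Bool) λ u → w ⊑ᵛ u × All (u ⊨ˡ_) t
  satisfying-completion w {t} t-consistent t≢0 =
    (λ i → completeWith (w i) (does ((i , true) ∈? t))) ,
    (λ i → ⊑-completeWith (w i) _) ,
    All.tabulate satisfies
    where
    satisfies : ∀ {i p} → (i , p) ∈ t → completeWith (w i) (does ((i , true) ∈? t)) ≡ p
    satisfies {i} {true} l∈t with w i | All.lookup t≢0 l∈t
    ... | 0ₖ | ≢0 = contradiction refl ≢0
    ... | ½ₖ | _  = dec-true ((i , true) ∈? t) l∈t
    ... | 1ₖ | _  = refl
    satisfies {i} {false} l∈t with w i | All.lookup t≢0 l∈t
    ... | 0ₖ | _  = refl
    ... | ½ₖ | _  = dec-false ((i , true) ∈? t) (λ x∈t → t-consistent (i , x∈t , l∈t))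
    ... | 1ₖ | ≢0 = contradiction refl ≢0

module _ {n : ℕ} {φ ψ : Expr n} (φ-canonical : MEqualsB φ)
  (φ≈ψ : ∀ (u : Fin n → Bool) → ⟦ φ ⟧ᴮ u ≡ ⟦ ψ ⟧ᴮ u) (w : Fin n → K₃) where

  trueLiterals-implicant : ⟦ ψ ⟧³ w ≡ 1ₖ → Implicant φ (trueLiterals w)
  trueLiterals-implicant ψ≡1 u γ-true =
    trans (φ≈ψ u) (⟦⟧ᴮ-completion ψ ψ≡1 (⊨trueLiterals⇒⊑ᵛ (⟦⟧ᵀ-sound (trueLiterals w) γ-true)))

  transfer-1 : ⟦ ψ ⟧³ w ≡ 1ₖ → ⟦ φ ⟧³ w ≡ 1ₖ
  transfer-1 ψ≡1
    with δ , δ-prime , δ⊆γ ← prime-implicant-⊆ φ trueLiterals-consistent (trueLiterals-implicant ψ≡1)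
    with t , t∈𝓜 , t⊆δ , _ ← proj₂ φ-canonical δ δ-prime
    with s , s∈dnf , s⊆t ← ∈-𝓜⁻ {φ = φ} t∈𝓜
    = trans (sym (⟦dnf⟧³ w true φ))
            (⟦⟧ᴰ³-1 w (lose s∈dnf (⟦⟧ᵀ³-1 w (All.tabulate λ l∈s →
              ∈-trueLiterals⁻ (δ⊆γ (t⊆δ (s⊆t l∈s)))))))

  transfer-0 : ⟦ ψ ⟧³ w ≡ 0ₖ → ⟦ φ ⟧³ w ≡ 0ₖ
  transfer-0 ψ≡0 = trans (sym (⟦dnf⟧³ w true φ)) (⟦⟧ᴰ³-0 w (All.tabulate term≡0))
    where
    term≡0 : ∀ {s} → s ∈ dnf true φ → ⟦ s ⟧ᵀ³ w ≡ 0ₖ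
    term≡0 s∈dnf with t , t∈𝓜 , t⊆s ← ∈-𝓜⁺ {φ = φ} s∈dnf with any? (λ l → ⟦ l ⟧ˡ³ w ≟ₖ 0ₖ) t
    ... | yes t-has-0 = ⟦⟧ᵀ³-0 w (Any-resp-⊆ t⊆s t-has-0)
    ... | no t-has-no-0
      with t-consistent , t-implicant , _ ← proj₁ φ-canonical t t∈𝓜
      with u , w⊑u , u⊨t ← satisfying-completion w t-consistent (¬Any⇒All¬ t t-has-no-0)
      = case trans (sym (⟦⟧ᴮ-completion ψ ψ≡0 w⊑u))
                   (trans (sym (φ≈ψ u)) (t-implicant u (⟦⟧ᵀ-complete u⊨t))) of λ ()

  transfer-known : ∀ b → ⟦ ψ ⟧³ w ≡ known b → ⟦ φ ⟧³ w ≡ known b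
  transfer-known true  = transfer-1
  transfer-known false = transfer-0

theorem3 : ∀ {n : ℕ} (φ : Expr n) → MEqualsB φ →
    ∀ (ψ : Expr n) → (∀ (u : Fin n → Bool) → ⟦ φ ⟧ᴮ u ≡ ⟦ ψ ⟧ᴮ u) →
    ∀ (v : Fin n → Ẑ) → ∣ ⟦ ψ ⟧ᴹ v ∣ᶻ ≤ᵐ ∣ ⟦ φ ⟧ᴹ v ∣ᶻ
theorem3 φ φ-canonical ψ φ≈ψ v = threshold-known⇒≤ᵐ φ-thresholded
  where
  m : Mag
  m = ∣ ⟦ ψ ⟧ᴹ v ∣ᶻ
  ψ-thresholded : ⟦ ψ ⟧³ (threshold m ∘ v) ≡ known (positive (⟦ ψ ⟧ᴹ v))
  ψ-thresholded = trans (sym (threshold-⟦⟧ m ψ v)) (threshold-at-magnitude (⟦ ψ ⟧ᴹ v))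
  φ-thresholded : threshold m (⟦ φ ⟧ᴹ v) ≡ known (positive (⟦ ψ ⟧ᴹ v))
  φ-thresholded = trans (threshold-⟦⟧ m φ v)
                        (transfer-known {φ = φ} {ψ} φ-canonical φ≈ψ (threshold m ∘ v) _ ψ-thresholded)
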